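{- For every pasture $P$, let $\lambda_P:\mathcal L_{\mathcal G}P\to P$ be its GRS-lift. Let $\mathbf{Lifts}_{\mathcal G}$ be the full subcategory of pastures consisting of those pastures $L$ for which $\lambda_L:\mathcal L_{\mathcal G}L\to L$ is an isomorphism. Then for every pasture $P$, every $L$ in $\mathbf{Lifts}_{\mathcal G}$ and every morphism $\alpha:L\to P$, there is a unique morphism $\hat\alpha:L\to\mathcal L_{\mathcal G}P$ such that $\alpha=\lambda_P\circ\hat\alpha$. In other words, $\mathcal L_{\mathcal G}$ defines a coreflection from the category of pastures onto $\mathbf{Lifts}_{\mathcal G}$.
   Context: A pasture is a commutative monoid $P$ (written multiplicatively, identity $1$) with an absorbing element $0$ such that $P^\times=P\setminus\{0\}$ is a group, together with a subset $N_P\subseteq\mathrm{Sym}_3(P)$ (the nullset), where $\mathrm{Sym}_3(P)$ is the quotient of $P^3$ by the permutation action of $S_3$ and the class of $(a,b,c)$ is written $a+b+c$, such that: (P1) $a+0+0\in N_P$ iff $a=0$; (P2) if $a+b+c\in N_P$ and $d\in P^\times$ then $da+db+dc\in N_P$; (P3) there is a unique $-1\in P^\times$ with $1+(-1)+0\in N_P$. Write $a+b=c$ or $a+b-c\in N_P$ for $a+b+(-c)\in N_P$. A morphism $f:P\to Q$ is a multiplicative map with $f(0)=0$, $f(1)=1$ preserving nullsets. $\mathbb F_1^\pm=\{0,1,-1\}$ with nullset $\{0+0+0,1+(-1)+0\}$ is the initial pasture. Presentations: given symbols $\{t_i\}_{i\in I}$ and a set $S$ of relations, each of the form $\alpha+\beta+\gamma\in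 N$ where $\alpha,\beta,\gamma$ are $0$ or $\pm$ Laurent monomials in the $t_i$ with at least two nonzero, the pasture $\mathbb F_1^\pm\langle t_i\mid i\in I\rangle/\!\!/S$ is a pasture $L$ with elements $t_i\in L^\times$ satisfying the relations in $S$ (in $N_L$), such that for every pasture $Q$ and every family $(q_i)\in (Q^\times)^I$ satisfying the relations of $S$ in $N_Q$ there is a unique morphism $L\to Q$ with $t_i\mapsto q_i$. A multiplicative relation $m=\pm1$ is encoded as $m+(\mp1)+0\in N$. A fundamental element of $P$ is $a\in P^\times$ such that $a+b-1\in N_P$ for some $b\in P^\times$; $P^{\circ}$ denotes the set of fundamental elements. The GRS-lift of $P$ is $\mathcal L_{\mathcal G}P=\mathbb F_1^\pm\langle t_a\mid a\in P^\circ\rangle/\!\!/S$, where $S$ consists of: (G1) $1+1+0\in N$ if $-1=1$ in $P$; (G2) $t_at_{a^{ -1}}=1$ for all $a\in P^\circ$; (G3) $t_a+t_b-1\in N$ whenever $a+b-1\in N_P$; (G4) $t_at_bt_c=-1$ whenever $a,b,c\in P^\circ$, $a+b^{ -1}-1\in N_P$ and $abc=-1$ in $P$; (G5) $t_at_bt_c=1$ whenever $a,b,c\in P^\circ$ and $abc=1$ in $P$. The morphism $\lambda_P:\mathcal L_{\mathcal G}P\to P$ sends $t_a\mapsto a$. -}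

module Defs where

open import Level using () renaming (suc to lsuc; zero to lzero)
open import Data.Product using (Σ; _×_; _,_; proj₁; proj₂)
open import Relation.Binary.PropositionalEquality using (_≡_; _≢_; refl; sym; trans; cong; subst)

-- The nullset N_P ⊆ Sym₃(P) is represented by a predicate on ordered
-- triples that is invariant under the S₃-action (closed under the two
-- generating transpositions); N a b c means "a + b + c ∈ N_P".

record Pasture : Set₁ where
  field
    Carrier : Set
    _·_     : Carrier → Carrier → Carrier
    one     : Carrier
    zero    : Carrier
    ·-assoc     : ∀ a b c → (a · b) · c ≡ a · (b · c)
    ·-comm      : ∀ a b → a · b ≡ b · a
    ·-identityˡ : ∀ a → one · a ≡ a
    zero-absorbˡ : ∀ a → zero · a ≡ zero
    one≢zero    : one ≢ zero
    ·-closed    : ∀ a b → a ≢ zero → b ≢ zero → a · b ≢ zero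
    inverse     : ∀ a → a ≢ zero → Σ Carrier λ b → a · b ≡ one
    N       : Carrier → Carrier → Carrier → Set
    N-swap₁₂ : ∀ a b c → N a b c → N b a c
    N-swap₂₃ : ∀ a b c → N a b c → N a c b
    P1⇒ : ∀ a → N a zero zero → a ≡ zero
    P1⇐ : N zero zero zero
    P2 : ∀ a b c d → N a b c → d ≢ zero → N (d · a) (d · b) (d · c)
    P3 : Σ Carrier λ m → (m ≢ zero) × N one m zero
           × (∀ m' → m' ≢ zero → N one m' zero → m' ≡ m)

  neg1 : Carrier
  neg1 = proj₁ P3

  neg1-null : N one neg1 zero
  neg1-null = proj₁ (proj₂ (proj₂ P3))

  neg : Carrier → Carrier
  neg x = neg1 · x

  Fund : Carrier → Set
  Fund a = (a ≢ zero) × Σ Carrier λ b → (b ≢ zero) × N a b neg1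

open Pasture

record Hom (P Q : Pasture) : Set where
  field
    fun    : Carrier P → Carrier Q
    fun-·  : ∀ a b → fun (_·_ P a b) ≡ _·_ Q (fun a) (fun b)
    fun-0  : fun (zero P) ≡ zero Q
    fun-1  : fun (one P) ≡ one Q
    fun-N  : ∀ a b c → N P a b c → N Q (fun a) (fun b) (fun c)

open Hom

idHom : (P : Pasture) → Hom P P
idHom P = record { fun = λ x → x ; fun-· = λ _ _ → refl ; fun-0 = refl
                 ; fun-1 = refl ; fun-N = λ _ _ _ n → n }

_∘H_ : {P Q R : Pasture} → Hom Q R → Hom P Q → Hom P R
_∘H_ {P} {Q} {R} g f = record
  { fun = λ x → fun g (fun f x)
  ; fun-· = λ a b → trans (cong (fun g) (fun-· f a b)) (fun-· g _ _)
  ; fun-0 = trans (cong (fun g) (fun-0 f)) (fun-0 g)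
  ; fun-1 = trans (cong (fun g) (fun-1 f)) (fun-1 g)
  ; fun-N = λ a b c n → fun-N g _ _ _ (fun-N f a b c n) }

_≈H_ : {P Q : Pasture} → Hom P Q → Hom P Q → Set
f ≈H g = ∀ x → fun f x ≡ fun g x

IsIso : {P Q : Pasture} → Hom P Q → Set
IsIso {P} {Q} f = Σ (Hom Q P) λ g → ((g ∘H f) ≈H idHom P) × ((f ∘H g) ≈H idHom Q)

-- Families are functions
-- with an (irrelevant) proof of fundamentality, so t_a depends on a only.
-- Multiplicative relations m = ±1 are encoded as m + (∓1) + 0 ∈ N.

Family : Pasture → Pasture → Set
Family P Q = (a : Carrier P) → .(Fund P a) → Carrier Q

record GRSRelations (P Q : Pasture) (q : Family P Q) : Set where
  field
    units : ∀ a (fa : Fund P a) → q a fa ≢ zero Q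
    G1 : neg1 P ≡ one P → N Q (one Q) (one Q) (zero Q)
    G2 : ∀ a b (fa : Fund P a) (fb : Fund P b) → _·_ P a b ≡ one P →
         N Q (_·_ Q (q a fa) (q b fb)) (neg1 Q) (zero Q)
    G3 : ∀ a b (fa : Fund P a) (fb : Fund P b) → N P a b (neg1 P) →
         N Q (q a fa) (q b fb) (neg1 Q)
    G4 : ∀ a b c binv (fa : Fund P a) (fb : Fund P b) (fc : Fund P c) →
         _·_ P b binv ≡ one P →
         N P a binv (neg1 P) →
         _·_ P (_·_ P a b) c ≡ neg1 P →
         N Q (_·_ Q (_·_ Q (q a fa) (q b fb)) (q c fc)) (one Q) (zero Q)
    G5 : ∀ a b c (fa : Fund P a) (fb : Fund P b) (fc : Fund P c) →
         _·_ P (_·_ P a b) c ≡ one P →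
         N Q (_·_ Q (_·_ Q (q a fa) (q b fb)) (q c fc)) (neg1 Q) (zero Q)

-- The GRS-lift of P, given by its defining presentation / universal property.
record GRSLift (P : Pasture) : Set₁ where
  field
    lift   : Pasture
    t      : Family P lift
    t-rels : GRSRelations P lift t
    univ   : (Q : Pasture) (q : Family P Q) → GRSRelations P Q q →
             Σ (Hom lift Q) λ f →
               (∀ a (fa : Fund P a) → fun f (t a fa) ≡ q a fa)
             × (∀ (g : Hom lift Q) → (∀ a (fa : Fund P a) → fun g (t a fa) ≡ q a fa)
                  → g ≈H f)

selfRels : (P : Pasture) → GRSRelations P P (λ a _ → a)
selfRels P = record
  { units = λ a fa → proj₁ fa
  ; G1 = λ e → subst (λ m → N P (one P) m (zero P)) e (neg1-null P)
  ; G2 = λ a b fa fb e → subst (λ m → N P m (neg1 P) (zero P)) (sym e) (neg1-null P)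
  ; G3 = λ a b fa fb n → n
  ; G4 = λ a b c binv fa fb fc _ _ e →
      subst (λ m → N P m (one P) (zero P)) (sym e)
        (N-swap₁₂ P _ _ _ (neg1-null P))
  ; G5 = λ a b c fa fb fc e → subst (λ m → N P m (neg1 P) (zero P)) (sym e) (neg1-null P)
  }

lambda : {P : Pasture} (G : GRSLift P) → Hom (GRSLift.lift G) P
lambda {P} G = proj₁ (GRSLift.univ G P (λ a _ → a) (selfRels P))

InLifts : (L : Pasture) → GRSLift L → Set
InLifts L G = IsIso (lambda G)

-- The crux is that every fundamental element of a GRS-lift L_G P is one of the
-- generators t_c (with c its image under λ_P).  Granting this, a morphism
-- α : L → P with L in Lifts_G lifts as α̂ = L_G(α) ∘ λ_L⁻¹, and any β with
-- λ_P ∘ β = α must send each fundamental a of L to the generator t_{α a}, so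
-- β ∘ λ_L = L_G(α) on generators and hence β = α̂.
--
-- To see the crux, cut the nullset of L_G P down to the triples x + y + z for
-- which every ratio −x/z (of two entries, all three nonzero) is a generator.
-- This is again a pasture nullset, and it still contains the defining relations
-- (for G3 this is a computation with G2 and G4), so by the universal property
-- the identity of L_G P maps into the restricted pasture: no triple is lost.
-- Applied to x + y − 1, the ratio −x/(−1) shows that a fundamental x is a
-- generator.

module Submission where

open import Defs
open import Data.Product using (Σ; _×_; _,_; proj₁; proj₂)
open import Data.Empty using (⊥-elim)
open import Relation.Binary.PropositionalEquality
open import Algebra.Bundles using (CommutativeMonoid)
import Algebra.Solver.CommutativeMonoid as CommutativeMonoidSolver

subst₃ : {A B C : Set} (R : A → B → C → Set) {a a′ : A} {b b′ : B} {c c′ : C} →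
         a ≡ a′ → b ≡ b′ → c ≡ c′ → R a b c → R a′ b′ c′
subst₃ R refl refl refl r = r

module PastureProperties (P : Pasture) where
  open Pasture P

  ·-identityʳ : ∀ a → a · one ≡ a
  ·-identityʳ a = trans (·-comm a one) (·-identityˡ a)

  zero-absorbʳ : ∀ a → a · zero ≡ zero
  zero-absorbʳ a = trans (·-comm a zero) (zero-absorbˡ a)

  ·-commutativeMonoid : CommutativeMonoid _ _
  ·-commutativeMonoid = record
    { Carrier = Carrier ; _≈_ = _≡_ ; _∙_ = _·_ ; ε = one
    ; isCommutativeMonoid = record
      { isMonoid = record
        { isSemigroup = record
          { isMagma = record { isEquivalence = isEquivalence ; ∙-cong = cong₂ _·_ }
          ; assoc = ·-assoc }
        ; identity = ·-identityˡ , ·-identityʳ }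
      ; comm = ·-comm } }

  module ·-Solver = CommutativeMonoidSolver ·-commutativeMonoid

  N-resp-≡ : ∀ {a b c a′ b′ c′} → a ≡ a′ → b ≡ b′ → c ≡ c′ → N a b c → N a′ b′ c′
  N-resp-≡ = subst₃ N

  ·≡one⇒≢zero : ∀ {a b} → a · b ≡ one → a ≢ zero
  ·≡one⇒≢zero {a} {b} ab≡1 a≡0 =
    one≢zero (trans (sym ab≡1) (trans (cong (_· b) a≡0) (zero-absorbˡ b)))

  ·≢zero⇒≢zeroʳ : ∀ {d x} → d · x ≢ zero → x ≢ zero
  ·≢zero⇒≢zeroʳ {d} dx≢0 x≡0 = dx≢0 (trans (cong (d ·_) x≡0) (zero-absorbʳ d))

  inv : ∀ a → a ≢ zero → Carrier
  inv a a≢0 = proj₁ (inverse a a≢0)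

  inv-inverseʳ : ∀ a (a≢0 : a ≢ zero) → a · inv a a≢0 ≡ one
  inv-inverseʳ a a≢0 = proj₂ (inverse a a≢0)

  inv-inverseˡ : ∀ a (a≢0 : a ≢ zero) → inv a a≢0 · a ≡ one
  inv-inverseˡ a a≢0 = trans (·-comm _ a) (inv-inverseʳ a a≢0)

  inv≢zero : ∀ a (a≢0 : a ≢ zero) → inv a a≢0 ≢ zero
  inv≢zero a a≢0 = ·≡one⇒≢zero (inv-inverseˡ a a≢0)

  ·-cancelʳ : ∀ {x y z} → z ≢ zero → x · z ≡ y · z → x ≡ y
  ·-cancelʳ {x} {y} {z} z≢0 xz≡yz = begin
    x                       ≡⟨ sym (·-identityʳ x) ⟩
    x · one                 ≡⟨ cong (x ·_) (sym (inv-inverseʳ z z≢0)) ⟩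
    x · (z · inv z z≢0)     ≡⟨ sym (·-assoc x z _) ⟩
    (x · z) · inv z z≢0     ≡⟨ cong (_· inv z z≢0) xz≡yz ⟩
    (y · z) · inv z z≢0     ≡⟨ ·-assoc y z _ ⟩
    y · (z · inv z z≢0)     ≡⟨ cong (y ·_) (inv-inverseʳ z z≢0) ⟩
    y · one                 ≡⟨ ·-identityʳ y ⟩
    y                       ∎
    where open ≡-Reasoning

  ·-cancelˡ : ∀ {x y z} → z ≢ zero → z · x ≡ z · y → x ≡ y
  ·-cancelˡ {x} {y} {z} z≢0 zx≡zy = ·-cancelʳ z≢0 (trans (·-comm x z) (trans zx≡zy (·-comm z y)))

  neg1≢zero : neg1 ≢ zero
  neg1≢zero = proj₁ (proj₂ P3)

  neg1-unique : ∀ m → m ≢ zero → N one m zero → m ≡ neg1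
  neg1-unique = proj₂ (proj₂ (proj₂ P3))

  neg1·neg1≡one : neg1 · neg1 ≡ one
  neg1·neg1≡one = trans (cong (neg1 ·_) (sym inv≡neg1)) (inv-inverseʳ neg1 neg1≢zero)
    where
      inv≡neg1 : inv neg1 neg1≢zero ≡ neg1
      inv≡neg1 = neg1-unique _ (inv≢zero neg1 neg1≢zero)
        (N-resp-≡ (inv-inverseˡ neg1 neg1≢zero) (·-identityʳ _) (zero-absorbʳ _)
          (P2 _ _ _ _ (N-swap₁₂ _ _ _ neg1-null) (inv≢zero neg1 neg1≢zero)))

  N-one⇒≡neg1 : ∀ x → x ≢ zero → N x one zero → x ≡ neg1
  N-one⇒≡neg1 x x≢0 n = neg1-unique x x≢0 (N-swap₁₂ _ _ _ n)

  N-neg1⇒≡one : ∀ x → x ≢ zero → N x neg1 zero → x ≡ one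
  N-neg1⇒≡one x x≢0 n = begin
    x                    ≡⟨ sym (·-identityˡ x) ⟩
    one · x              ≡⟨ cong (_· x) (sym neg1·neg1≡one) ⟩
    (neg1 · neg1) · x    ≡⟨ ·-assoc neg1 neg1 x ⟩
    neg1 · (neg1 · x)    ≡⟨ cong (neg1 ·_) neg1·x≡neg1 ⟩
    neg1 · neg1          ≡⟨ neg1·neg1≡one ⟩
    one                  ∎
    where
      open ≡-Reasoning
      neg1·x≡neg1 : neg1 · x ≡ neg1
      neg1·x≡neg1 = N-one⇒≡neg1 _ (·-closed _ _ neg1≢zero x≢0)
        (N-resp-≡ refl neg1·neg1≡one (zero-absorbʳ neg1) (P2 _ _ _ _ n neg1≢zero))

  -- a + b = 1 scaled by −b⁻¹.
  N-neg-div : ∀ {a b} (b≢0 : b ≢ zero) → N a b neg1 → N (neg (a · inv b b≢0)) (inv b b≢0) neg1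
  N-neg-div {a} {b} b≢0 n =
    N-swap₂₃ _ _ _ (N-resp-≡ da≡ db≡neg1 dneg1≡b⁻¹ (P2 _ _ _ d n d≢0))
    where
      open ·-Solver
      b⁻¹ = inv b b≢0
      d = neg1 · b⁻¹
      d≢0 : d ≢ zero
      d≢0 = ·-closed _ _ neg1≢zero (inv≢zero b b≢0)
      da≡ : d · a ≡ neg (a · b⁻¹)
      da≡ = solve 3 (λ m u a → (m ⊕ u) ⊕ a ⊜ m ⊕ (a ⊕ u)) refl neg1 b⁻¹ a
      db≡neg1 : d · b ≡ neg1
      db≡neg1 = trans (·-assoc neg1 b⁻¹ b)
                      (trans (cong (neg1 ·_) (inv-inverseˡ b b≢0)) (·-identityʳ neg1))
      dneg1≡b⁻¹ : d · neg1 ≡ b⁻¹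
      dneg1≡b⁻¹ = trans (solve 2 (λ m u → (m ⊕ u) ⊕ m ⊜ (m ⊕ m) ⊕ u) refl neg1 b⁻¹)
                        (trans (cong (_· b⁻¹) neg1·neg1≡one) (·-identityˡ b⁻¹))

  ·-inv-neg-div≡neg1 : ∀ {a b} (a≢0 : a ≢ zero) (b≢0 : b ≢ zero) →
                       (b · inv a a≢0) · neg (a · inv b b≢0) ≡ neg1
  ·-inv-neg-div≡neg1 {a} {b} a≢0 b≢0 = begin
    (b · a⁻¹) · (neg1 · (a · b⁻¹))   ≡⟨ solve 5 (λ b a′ m a b′ → (b ⊕ a′) ⊕ (m ⊕ (a ⊕ b′))
                                          ⊜ m ⊕ ((a ⊕ a′) ⊕ (b ⊕ b′))) refl b a⁻¹ neg1 a b⁻¹ ⟩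
    neg1 · ((a · a⁻¹) · (b · b⁻¹))   ≡⟨ cong₂ (λ u v → neg1 · (u · v))
                                          (inv-inverseʳ a a≢0) (inv-inverseʳ b b≢0) ⟩
    neg1 · (one · one)               ≡⟨ cong (neg1 ·_) (·-identityˡ one) ⟩
    neg1 · one                       ≡⟨ ·-identityʳ neg1 ⟩
    neg1                             ∎
    where
      open ≡-Reasoning
      open ·-Solver
      a⁻¹ = inv a a≢0
      b⁻¹ = inv b b≢0

  Fund-neg-div : ∀ {a b} → a ≢ zero → (b≢0 : b ≢ zero) → N a b neg1 → Fund (neg (a · inv b b≢0))
  Fund-neg-div a≢0 b≢0 n =
    ·-closed _ _ neg1≢zero (·-closed _ _ a≢0 (inv≢zero _ b≢0)) , _ , inv≢zero _ b≢0 , N-neg-div b≢0 n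

  Fund-inv : ∀ {b} (fb : Fund b) → Fund (inv b (proj₁ fb))
  Fund-inv (b≢0 , c , c≢0 , n) =
    inv≢zero _ b≢0 , _ , proj₁ (Fund-neg-div c≢0 b≢0 (N-swap₁₂ _ _ _ n)) ,
    N-swap₁₂ _ _ _ (N-neg-div b≢0 (N-swap₁₂ _ _ _ n))

open Pasture
open Hom

module HomProperties {P Q : Pasture} (f : Hom P Q) where
  private
    module P = PastureProperties P
    module Q = PastureProperties Q

  fun-≢zero : ∀ {a} → a ≢ zero P → fun f a ≢ zero Q
  fun-≢zero {a} a≢0 = Q.·≡one⇒≢zero
    (trans (sym (fun-· f _ _)) (trans (cong (fun f) (P.inv-inverseʳ a a≢0)) (fun-1 f)))

  fun-neg1 : fun f (neg1 P) ≡ neg1 Q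
  fun-neg1 = Q.neg1-unique _ (fun-≢zero P.neg1≢zero)
    (Q.N-resp-≡ (fun-1 f) refl (fun-0 f) (fun-N f _ _ _ (neg1-null P)))

  fun-N-neg1 : ∀ {a b} → N P a b (neg1 P) → N Q (fun f a) (fun f b) (neg1 Q)
  fun-N-neg1 n = subst (N Q _ _) fun-neg1 (fun-N f _ _ _ n)

  fun-≡one : ∀ {a} → a ≡ one P → fun f a ≡ one Q
  fun-≡one a≡1 = trans (cong (fun f) a≡1) (fun-1 f)

  fun-·₃ : ∀ a b c → fun f (_·_ P (_·_ P a b) c) ≡ _·_ Q (_·_ Q (fun f a) (fun f b)) (fun f c)
  fun-·₃ a b c = trans (fun-· f _ c) (cong (λ x → _·_ Q x (fun f c)) (fun-· f a b))

  fun-Fund : ∀ {a} → Fund P a → Fund Q (fun f a)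
  fun-Fund (a≢0 , b , b≢0 , n) = fun-≢zero a≢0 , fun f b , fun-≢zero b≢0 , fun-N-neg1 n

open HomProperties using (fun-Fund)

GRSRelations-precompose : {L P Q : Pasture} (α : Hom L P) {q : Family P Q} →
  GRSRelations P Q q → GRSRelations L Q (λ a fa → q (fun α a) (fun-Fund α fa))
GRSRelations-precompose {L} {P} α rels = record
  { units = λ a fa → units _ (F fa)
  ; G1 = λ neg1≡1 → G1 (trans (sym fun-neg1) (fun-≡one neg1≡1))
  ; G2 = λ a b fa fb ab≡1 → G2 _ _ (F fa) (F fb) (trans (sym (fun-· α a b)) (fun-≡one ab≡1))
  ; G3 = λ a b fa fb n → G3 _ _ (F fa) (F fb) (fun-N-neg1 n)
  ; G4 = λ a b c b⁻¹ fa fb fc bb⁻¹≡1 n abc≡neg1 →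
      G4 _ _ _ (fun α b⁻¹) (F fa) (F fb) (F fc) (trans (sym (fun-· α b b⁻¹)) (fun-≡one bb⁻¹≡1))
        (fun-N-neg1 n) (trans (sym (fun-·₃ a b c)) (trans (cong (fun α) abc≡neg1) fun-neg1))
  ; G5 = λ a b c fa fb fc abc≡1 →
      G5 _ _ _ (F fa) (F fb) (F fc) (trans (sym (fun-·₃ a b c)) (fun-≡one abc≡1))
  }
  where
    open GRSRelations rels
    open HomProperties α renaming (fun-Fund to F)

module GRSLiftProperties {P : Pasture} (G : GRSLift P) where
  open GRSLift G

  lift-hom-unique : {Q : Pasture} {q : Family P Q} → GRSRelations P Q q → (g h : Hom lift Q) →
                    (∀ a fa → fun g (t a fa) ≡ q a fa) → (∀ a fa → fun h (t a fa) ≡ q a fa) →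
                    g ≈H h
  lift-hom-unique {Q} {q} rels g h gq hq x = trans (unique g gq x) (sym (unique h hq x))
    where unique = proj₂ (proj₂ (univ Q q rels))

  lambda-t : ∀ a fa → fun (lambda G) (t a fa) ≡ a
  lambda-t = proj₁ (proj₂ (univ P (λ a _ → a) (selfRels P)))

  t-cong : ∀ {a b} → a ≡ b → (fa : Fund P a) (fb : Fund P b) → t a fa ≡ t b fb
  t-cong refl _ _ = refl

GRSLift-map : {L P : Pasture} (GL : GRSLift L) (GP : GRSLift P) (α : Hom L P) →
              Σ (Hom (GRSLift.lift GL) (GRSLift.lift GP)) λ f →
                ∀ a fa → fun f (GRSLift.t GL a fa) ≡ GRSLift.t GP (fun α a) (fun-Fund α fa)
GRSLift-map GL GP α = proj₁ U , proj₁ (proj₂ U)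
  where
    U = GRSLift.univ GL _ _ (GRSRelations-precompose α (GRSLift.t-rels GP))

lambda-natural : {L P : Pasture} (GL : GRSLift L) (GP : GRSLift P) (α : Hom L P) →
                 (lambda GP ∘H proj₁ (GRSLift-map GL GP α)) ≈H (α ∘H lambda GL)
lambda-natural {L} {P} GL GP α =
  GRSLiftProperties.lift-hom-unique GL (GRSRelations-precompose α (selfRels P))
    (lambda GP ∘H proj₁ (GRSLift-map GL GP α)) (α ∘H lambda GL)
    (λ a fa → trans (cong (fun (lambda GP)) (proj₂ (GRSLift-map GL GP α) a fa))
                    (GRSLiftProperties.lambda-t GP (fun α a) (fun-Fund α fa)))
    (λ a fa → cong (fun α) (GRSLiftProperties.lambda-t GL a fa))

record ClosedTriplePredicate (P : Pasture) : Set₁ where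
  field
    holds   : Carrier P → Carrier P → Carrier P → Set
    swap₁₂  : ∀ {x y z} → holds x y z → holds y x z
    swap₂₃  : ∀ {x y z} → holds x y z → holds x z y
    scale   : ∀ {x y z d} → d ≢ zero P → holds x y z → holds (_·_ P d x) (_·_ P d y) (_·_ P d z)
    zero₃   : ∀ {x y} → holds x y (zero P)

restrictNullset : (P : Pasture) → ClosedTriplePredicate P → Pasture
restrictNullset P C = record
  { Carrier = Carrier P ; _·_ = _·_ P ; one = one P ; zero = zero P
  ; ·-assoc = ·-assoc P ; ·-comm = ·-comm P ; ·-identityˡ = ·-identityˡ P
  ; zero-absorbˡ = zero-absorbˡ P ; one≢zero = one≢zero P ; ·-closed = ·-closed P
  ; inverse = inverse P
  ; N = λ a b c → N P a b c × holds a b c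
  ; N-swap₁₂ = λ a b c (n , h) → N-swap₁₂ P a b c n , swap₁₂ h
  ; N-swap₂₃ = λ a b c (n , h) → N-swap₂₃ P a b c n , swap₂₃ h
  ; P1⇒ = λ a (n , _) → P1⇒ P a n
  ; P1⇐ = P1⇐ P , zero₃
  ; P2 = λ a b c d (n , h) d≢0 → P2 P a b c d n d≢0 , scale d≢0 h
  ; P3 = neg1 P , P.neg1≢zero , (neg1-null P , zero₃) , λ m m≢0 (n , _) → P.neg1-unique m m≢0 n
  }
  where
    open ClosedTriplePredicate C
    module P = PastureProperties P

-- Every relation of the presentation other than G3 has a zero entry, so G3 is the only case.
lift-N-induction : {P : Pasture} (G : GRSLift P) (C : ClosedTriplePredicate (GRSLift.lift G)) →
  (∀ a b (fa : Fund P a) (fb : Fund P b) → N P a b (neg1 P) →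
     ClosedTriplePredicate.holds C (GRSLift.t G a fa) (GRSLift.t G b fb) (neg1 (GRSLift.lift G))) →
  ∀ {x y z} → N (GRSLift.lift G) x y z → ClosedTriplePredicate.holds C x y z
lift-N-induction {P} G C holds-G3 {x} {y} {z} n =
  subst₃ holds (h-id x) (h-id y) (h-id z) (proj₂ (fun-N h x y z n))
  where
    open GRSLift G
    open GRSRelations t-rels
    open ClosedTriplePredicate C
    Q = restrictNullset lift C

    t-relsQ : GRSRelations P Q t
    t-relsQ = record
      { units = units
      ; G1 = λ e → G1 e , zero₃
      ; G2 = λ a b fa fb e → G2 a b fa fb e , zero₃
      ; G3 = λ a b fa fb n → G3 a b fa fb n , holds-G3 a b fa fb n
      ; G4 = λ a b c b⁻¹ fa fb fc e n e′ → G4 a b c b⁻¹ fa fb fc e n e′ , zero₃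
      ; G5 = λ a b c fa fb fc e → G5 a b c fa fb fc e , zero₃
      }

    h : Hom lift Q
    h = proj₁ (univ Q t t-relsQ)

    forget : Hom Q lift
    forget = record { fun = λ x → x ; fun-· = λ _ _ → refl ; fun-0 = refl ; fun-1 = refl
                    ; fun-N = λ _ _ _ → proj₁ }

    h-id : ∀ x → fun h x ≡ x
    h-id = GRSLiftProperties.lift-hom-unique G t-rels (forget ∘H h) (idHom lift)
             (proj₁ (proj₂ (univ Q t t-relsQ))) (λ _ _ → refl)

module Generators {P : Pasture} (G : GRSLift P) where
  open GRSLift G
  open GRSRelations t-rels
  open GRSLiftProperties G
  private
    module P = PastureProperties P
    module L = PastureProperties lift
    infixl 7 _*_
    _*_ = _·_ lift

  IsGenerator : Carrier lift → Set
  IsGenerator r = Σ (Carrier P) λ c → Σ (Fund P c) λ fc → r ≡ t c fc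

  NegRatioIsGenerator : Carrier lift → Carrier lift → Set
  NegRatioIsGenerator x z = ∀ r → r * z ≡ neg1 lift * x → IsGenerator r

  NegRatioIsGenerator-t : ∀ {x z} c (fc : Fund P c) → z ≢ zero lift → t c fc * z ≡ neg1 lift * x →
                          NegRatioIsGenerator x z
  NegRatioIsGenerator-t c fc z≢0 tc·z≡-x r rz≡-x =
    c , fc , L.·-cancelʳ z≢0 (trans rz≡-x (sym tc·z≡-x))

  NegRatioIsGenerator-scale : ∀ {x z d} → d ≢ zero lift → NegRatioIsGenerator x z →
                              NegRatioIsGenerator (d * x) (d * z)
  NegRatioIsGenerator-scale {x} {z} {d} d≢0 gen r rdz≡-dx = gen r (L.·-cancelˡ d≢0 (begin
    d * (r * z)           ≡⟨ solve 3 (λ d r z → d ⊕ (r ⊕ z) ⊜ r ⊕ (d ⊕ z)) refl d r z ⟩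
    r * (d * z)           ≡⟨ rdz≡-dx ⟩
    neg1 lift * (d * x)   ≡⟨ solve 3 (λ m d x → m ⊕ (d ⊕ x) ⊜ d ⊕ (m ⊕ x)) refl (neg1 lift) d x ⟩
    d * (neg1 lift * x)   ∎))
    where
      open ≡-Reasoning
      open L.·-Solver

  GeneratorTriple : Carrier lift → Carrier lift → Carrier lift → Set
  GeneratorTriple x y z = x ≢ zero lift → y ≢ zero lift → z ≢ zero lift →
    NegRatioIsGenerator x y × NegRatioIsGenerator y x × NegRatioIsGenerator x z ×
    NegRatioIsGenerator z x × NegRatioIsGenerator y z × NegRatioIsGenerator z y

  GeneratorTriple-scale : ∀ {x y z d} → d ≢ zero lift → GeneratorTriple x y z →
                          GeneratorTriple (d * x) (d * y) (d * z)
  GeneratorTriple-scale {d = d} d≢0 h dx≢0 dy≢0 dz≢0 =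
    let (xy , yx , xz , zx , yz , zy) =
          h (L.·≢zero⇒≢zeroʳ dx≢0) (L.·≢zero⇒≢zeroʳ dy≢0) (L.·≢zero⇒≢zeroʳ dz≢0)
    in scale xy , scale yx , scale xz , scale zx , scale yz , scale zy
    where
      scale : ∀ {x z} → NegRatioIsGenerator x z → NegRatioIsGenerator (d * x) (d * z)
      scale = NegRatioIsGenerator-scale d≢0

  generatorTriples : ClosedTriplePredicate lift
  generatorTriples = record
    { holds  = GeneratorTriple
    ; swap₁₂ = λ h y≢0 x≢0 z≢0 → let (xy , yx , xz , zx , yz , zy) = h x≢0 y≢0 z≢0
                                  in yx , xy , yz , zy , xz , zx
    ; swap₂₃ = λ h x≢0 z≢0 y≢0 → let (xy , yx , xz , zx , yz , zy) = h x≢0 y≢0 z≢0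
                                  in xz , zx , xy , yx , zy , yz
    ; scale  = GeneratorTriple-scale
    ; zero₃  = λ _ _ z≢0 → ⊥-elim (z≢0 refl)
    }

  t-inv·t≡one : ∀ a (fa : Fund P a) → t (P.inv a (proj₁ fa)) (P.Fund-inv fa) * t a fa ≡ one lift
  t-inv·t≡one a fa = L.N-neg1⇒≡one _ (·-closed lift _ _ (units _ fa⁻¹) (units _ fa))
    (G2 _ _ fa⁻¹ fa (P.inv-inverseˡ a (proj₁ fa)))
    where fa⁻¹ = P.Fund-inv fa

  -- G4 applied to b · a⁻¹ · (−a/b) = −1, which is allowed because b + (a⁻¹)⁻¹ = 1.
  t-neg-div·t≡-t : ∀ a b (fa : Fund P a) (fb : Fund P b) (n : N P a b (neg1 P)) →
    t (neg P (_·_ P a (P.inv b (proj₁ fb)))) (P.Fund-neg-div (proj₁ fa) (proj₁ fb) n) * t b fb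
      ≡ neg1 lift * t a fa
  t-neg-div·t≡-t a b fa fb n = begin
    tc * tb                     ≡⟨ sym (L.·-identityʳ _) ⟩
    tc * tb * one lift          ≡⟨ cong (tc * tb *_) (sym (t-inv·t≡one a fa)) ⟩
    tc * tb * (ta⁻¹ * ta)       ≡⟨ solve 4 (λ c b a′ a → (c ⊕ b) ⊕ (a′ ⊕ a) ⊜ ((b ⊕ a′) ⊕ c) ⊕ a)
                                     refl tc tb ta⁻¹ ta ⟩
    tb * ta⁻¹ * tc * ta         ≡⟨ cong (_* ta) tb·ta⁻¹·tc≡neg1 ⟩
    neg1 lift * ta              ∎
    where
      open ≡-Reasoning
      open L.·-Solver
      fa⁻¹ = P.Fund-inv fa
      fc = P.Fund-neg-div (proj₁ fa) (proj₁ fb) n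
      ta = t a fa
      tb = t b fb
      ta⁻¹ = t _ fa⁻¹
      tc = t _ fc
      tb·ta⁻¹·tc≡neg1 : tb * ta⁻¹ * tc ≡ neg1 lift
      tb·ta⁻¹·tc≡neg1 = L.N-one⇒≡neg1 _
        (·-closed lift _ _ (·-closed lift _ _ (units _ fb) (units _ fa⁻¹)) (units _ fc))
        (G4 _ _ _ a fb fa⁻¹ fc (P.inv-inverseˡ a (proj₁ fa)) (N-swap₁₂ P _ _ _ n)
          (P.·-inv-neg-div≡neg1 (proj₁ fa) (proj₁ fb)))

  GeneratorTriple-G3 : ∀ a b (fa : Fund P a) (fb : Fund P b) → N P a b (neg1 P) →
                       GeneratorTriple (t a fa) (t b fb) (neg1 lift)
  GeneratorTriple-G3 a b fa fb n _ _ _ =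
      NegRatioIsGenerator-t _ (P.Fund-neg-div (proj₁ fa) (proj₁ fb) n) (units b fb)
        (t-neg-div·t≡-t a b fa fb n)
    , NegRatioIsGenerator-t _ (P.Fund-neg-div (proj₁ fb) (proj₁ fa) n′) (units a fa)
        (t-neg-div·t≡-t b a fb fa n′)
    , NegRatioIsGenerator-t a fa L.neg1≢zero (·-comm lift _ _)
    , NegRatioIsGenerator-t _ (P.Fund-inv fa) (units a fa)
        (trans (t-inv·t≡one a fa) (sym L.neg1·neg1≡one))
    , NegRatioIsGenerator-t b fb L.neg1≢zero (·-comm lift _ _)
    , NegRatioIsGenerator-t _ (P.Fund-inv fb) (units b fb)
        (trans (t-inv·t≡one b fb) (sym L.neg1·neg1≡one))
    where n′ = N-swap₁₂ P _ _ _ n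

  Fund⇒IsGenerator : ∀ {x} → Fund lift x → IsGenerator x
  Fund⇒IsGenerator {x} (x≢0 , y , y≢0 , n) =
    let (_ , _ , x/-1 , _ , _ , _) =
          lift-N-induction G generatorTriples GeneratorTriple-G3 n x≢0 y≢0 L.neg1≢zero
    in x/-1 x (·-comm lift x _)

  Fund⇒≡t-lambda : ∀ {x} (fx : Fund lift x) → x ≡ t (fun (lambda G) x) (fun-Fund (lambda G) fx)
  Fund⇒≡t-lambda {x} fx =
    let (c , fc , x≡tc) = Fund⇒IsGenerator fx
    in trans x≡tc (t-cong (sym (trans (cong (fun (lambda G)) x≡tc) (lambda-t c fc))) fc
                          (fun-Fund (lambda G) fx))

lambda-factor-on-Fund : {L P : Pasture} (GP : GRSLift P) (α : Hom L P) (β : Hom L (GRSLift.lift GP)) →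
  α ≈H (lambda GP ∘H β) → ∀ a (fa : Fund L a) → fun β a ≡ GRSLift.t GP (fun α a) (fun-Fund α fa)
lambda-factor-on-Fund GP α β α≈λβ a fa =
  trans (Generators.Fund⇒≡t-lambda GP fβa)
        (GRSLiftProperties.t-cong GP (sym (α≈λβ a)) (fun-Fund (lambda GP) fβa) (fun-Fund α fa))
  where fβa = fun-Fund β fa

proposition2p8 : (P : Pasture) (GP : GRSLift P) (L : Pasture) (GL : GRSLift L) →
                 InLifts L GL → (α : Hom L P) →
                 Σ (Hom L (GRSLift.lift GP)) λ αhat →
                   (α ≈H (lambda GP ∘H αhat))
                   × (∀ (β : Hom L (GRSLift.lift GP)) → α ≈H (lambda GP ∘H β) → β ≈H αhat)
proposition2p8 P GP L GL (λL⁻¹ , _ , λL∘λL⁻¹≈id) α = Lα ∘H λL⁻¹ , factors , unique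
  where
    Lα = proj₁ (GRSLift-map GL GP α)

    factors : α ≈H (lambda GP ∘H (Lα ∘H λL⁻¹))
    factors x = sym (trans (lambda-natural GL GP α (fun λL⁻¹ x)) (cong (fun α) (λL∘λL⁻¹≈id x)))

    unique : ∀ β → α ≈H (lambda GP ∘H β) → β ≈H (Lα ∘H λL⁻¹)
    unique β α≈λβ x = trans (cong (fun β) (sym (λL∘λL⁻¹≈id x)))
      (GRSLiftProperties.lift-hom-unique GL (GRSRelations-precompose α (GRSLift.t-rels GP))
        (β ∘H lambda GL) Lα β∘λL-on-t (proj₂ (GRSLift-map GL GP α)) (fun λL⁻¹ x))
      where
        β∘λL-on-t : ∀ a fa → fun β (fun (lambda GL) (GRSLift.t GL a fa))
                                ≡ GRSLift.t GP (fun α a) (fun-Fund α fa)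
        β∘λL-on-t a fa = trans (cong (fun β) (GRSLiftProperties.lambda-t GL a fa))
                               (lambda-factor-on-Fund GP α β α≈λβ a fa)
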